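{- Let $h:\mathbb{N}\setminus\{0\}\to\mathbb{N}\setminus\{0\}$ be a function which has a finite-fold Diophantine representation. Then there exists a positive integer $m$ such that $h(n)<\tau(n)$ for every integer $n>m$.
   Context: $\mathbb{N}=\{0,1,2,\ldots\}$. A function $h:\mathbb{N}\setminus\{0\}\to\mathbb{N}\setminus\{0\}$ has a finite-fold Diophantine representation if there is a polynomial $W(x_1,x_2,y_1,\ldots,y_r)$ with integer coefficients such that for all positive integers $x_1,x_2$: $h(x_1)=x_2$ if and only if there exist $y_1,\ldots,y_r\in\mathbb{N}$ with $W(x_1,x_2,y_1,\ldots,y_r)=0$, and for all positive integers $x_1,x_2$ only finitely many tuples $(y_1,\ldots,y_r)\in\mathbb{N}^r$ satisfy $W(x_1,x_2,y_1,\ldots,y_r)=0$. For a positive integer $n$, $\tau(n)$ denotes the smallest positive integer $b$ such that for every system $T\subseteq\{x_i+1=x_k,\ x_i\cdot x_j=x_k:\ i,j,k\in\{1,\ldots,n\}\}$ having only finitely many solutions in positive integers $x_1,\ldots,x_n$, all these solutions belong to $[1,b]^n$. -}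

module Defs where

open import Data.Nat using (ℕ; zero; suc; _+_; _*_; _≤_; _<_)
open import Data.Integer as ℤ using (ℤ; +_)
open import Data.Fin using (Fin)
open import Data.Vec using (Vec; lookup; _∷_)
open import Data.List using (List)
open import Data.List.Relation.Unary.All using (All)
open import Data.List.Membership.Propositional using (_∈_)
open import Data.Product using (Σ; ∃; _×_; Σ-syntax; ∃-syntax; proj₁)
open import Relation.Binary.PropositionalEquality using (_≡_)
open import Function.Bundles using (_⇔_)

ℕ⁺ : Set
ℕ⁺ = Σ[ n ∈ ℕ ] 0 < n

data Poly (k : ℕ) : Set where
  con  : ℤ → Poly k
  var  : Fin k → Poly k
  _⊕_  : Poly k → Poly k → Poly k
  _⊗_  : Poly k → Poly k → Poly k

eval : ∀ {k} → Poly k → Vec ℕ k → ℤ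
eval (con c) v = c
eval (var i) v = + (lookup v i)
eval (p ⊕ q) v = eval p v ℤ.+ eval q v
eval (p ⊗ q) v = eval p v ℤ.* eval q v

FiniteSet : ∀ {r} → (Vec ℕ r → Set) → Set
FiniteSet {r} P = ∃[ L ] (∀ (y : Vec ℕ r) → P y → y ∈ L)

FiniteFoldDiophantine : (ℕ⁺ → ℕ⁺) → Set
FiniteFoldDiophantine h =
  ∃[ r ] Σ[ W ∈ Poly (2 + r) ]
    ( (∀ (x₁ x₂ : ℕ⁺) →
         (proj₁ (h x₁) ≡ proj₁ x₂)
           ⇔ (∃[ y ] eval W (proj₁ x₁ ∷ proj₁ x₂ ∷ y) ≡ + 0))
    × (∀ (x₁ x₂ : ℕ⁺) →
         FiniteSet (λ (y : Vec ℕ r) → eval W (proj₁ x₁ ∷ proj₁ x₂ ∷ y) ≡ + 0)))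

data Equation (n : ℕ) : Set where
  plusOne : (i k : Fin n) → Equation n
  times   : (i j k : Fin n) → Equation n

Holds : ∀ {n} → Vec ℕ n → Equation n → Set
Holds x (plusOne i k) = lookup x i + 1 ≡ lookup x k
Holds x (times i j k) = lookup x i * lookup x j ≡ lookup x k

System : ℕ → Set
System n = List (Equation n)

IsPosSolution : ∀ {n} → System n → Vec ℕ n → Set
IsPosSolution {n} T x = (∀ (i : Fin n) → 1 ≤ lookup x i) × All (Holds x) T

BoundsSystems : ℕ → ℕ → Set
BoundsSystems n b =
  ∀ (T : System n) → FiniteSet (IsPosSolution T) →
  ∀ (x : Vec ℕ n) → IsPosSolution T x → ∀ (i : Fin n) → lookup x i ≤ b

IsTau : ℕ → ℕ → Set
IsTau n b = 1 ≤ b × BoundsSystems n b × (∀ b' → 1 ≤ b' → BoundsSystems n b' → b ≤ b')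

>-pos : ∀ {m n : ℕ} → m < n → 0 < n
>-pos {m} {suc n} _ = Data.Nat.s≤s Data.Nat.z≤n

-- The positive solutions of a system of equations  x_i + 1 = x_k,  x_i · x_j = x_k  can
-- simulate a straight-line evaluation of W(n, x₂, y): an integer is carried as a difference
-- x_a - x_b of two unknowns, a product of differences expands into sums of products, and a sum
-- z = x + y is pinned down by (z x + 1)(z y + 1) = z²(x y + 1) + 1.  Unknowns holding 1, 2, …, N + 1
-- supply the constants of W and, through one more sum, the value n + 1.  Once n exceeds a bound
-- depending only on W, all of this fits into exactly n unknowns, and the resulting system has
-- precisely one solution for each (x₂, y) with W(n, x₂, y) = 0, one of its unknowns being x₂ + 1.
-- Finite-foldness forces x₂ = h(n) and leaves finitely many y, so the system has finitely many
-- solutions and τ(n) ≥ h(n) + 1.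
module Submission where

open import Defs
open import Data.Nat using (ℕ; _<_; _≤_)
open import Data.Product using (Σ; ∃; _×_; Σ-syntax; ∃-syntax; proj₁; _,_)

open import Data.Empty using (⊥-elim)
open import Data.Fin as Fin using (Fin; toℕ; fromℕ<)
import Data.Fin.Properties as Fin
open import Data.Integer as ℤ using (ℤ; -[1+_])
import Data.Integer.Properties as ℤ
import Data.Integer.Tactic.RingSolver as ℤ-Solver
open import Data.List as List using (List; []; _∷_; _++_)
open import Data.List.Membership.Propositional using (_∈_)
open import Data.List.Membership.Propositional.Properties using (∈-map⁺)
open import Data.List.Relation.Unary.All as All using (All; []; _∷_)
open import Data.List.Relation.Unary.All.Properties using (++⁺; ++⁻; map⁺; map⁻)
open import Data.Nat
open import Data.Nat.Properties
open import Algebra.Properties.CommutativeSemigroup +-commutativeSemigroup using (x∙yz≈yx∙z)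
open import Data.Nat.Tactic.RingSolver using (solve-∀)
open import Data.Product using (proj₂)
open import Data.Sum using (_⊎_; inj₁; inj₂)
open import Data.Unit using (⊤; tt)
open import Data.Vec as Vec using (Vec; _∷_; lookup; tabulate)
import Data.Vec.Properties as Vec
open import Function.Bundles using (Equivalence)
open import Relation.Binary.PropositionalEquality
open import Relation.Nullary using (yes; no)
open import Relation.Nullary.Decidable using (True; toWitness)

Valuation : Set
Valuation = ℕ → ℕ

Positive : Valuation → Set
Positive g = ∀ m → 1 ≤ g m

PositiveBelow : ℕ → Valuation → Set
PositiveBelow k g = ∀ m → m < k → 1 ≤ g m

AgreeBelow : ℕ → Valuation → Valuation → Set
AgreeBelow k g f = ∀ m → m < k → g m ≡ f m

data Constraint : Set where
  inc : ℕ → ℕ → Constraint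
  mul : ℕ → ℕ → ℕ → Constraint

_⊨_ : Valuation → Constraint → Set
g ⊨ inc i k   = g i + 1 ≡ g k
g ⊨ mul i j k = g i * g j ≡ g k

sum-forced : ∀ z x y → 1 ≤ z → (z * x + 1) * (z * y + 1) ≡ z * z * (x * y + 1) + 1 → z ≡ x + y
sum-forced z@(suc _) x y _ e = sym (*-cancelˡ-≡ (x + y) z z (+-cancelʳ-≡ 1 _ _ z[x+y]+1≡z*z+1))
  where
  expandˡ : ∀ z x y → (z * x + 1) * (z * y + 1) ≡ z * z * (x * y) + (z * (x + y) + 1)
  expandˡ = solve-∀
  expandʳ : ∀ z x y → z * z * (x * y + 1) + 1 ≡ z * z * (x * y) + (z * z + 1)
  expandʳ = solve-∀
  z[x+y]+1≡z*z+1 : z * (x + y) + 1 ≡ z * z + 1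
  z[x+y]+1≡z*z+1 = +-cancelˡ-≡ (z * z * (x * y)) _ _
    (trans (sym (expandˡ z x y)) (trans e (expandʳ z x y)))

data Instr : Set where
  one  : Instr
  succ : ℕ → Instr
  prod : ℕ → ℕ → Instr
  sum  : ℕ → ℕ → Instr

width : Instr → ℕ
width (sum _ _) = 10
width _         = 1

sumGadget : ℕ → ℕ → ℕ → ℕ
sumGadget x y 0 = x + y
sumGadget x y 1 = (x + y) * x
sumGadget x y 2 = (x + y) * x + 1
sumGadget x y 3 = (x + y) * y
sumGadget x y 4 = (x + y) * y + 1
sumGadget x y 5 = ((x + y) * x + 1) * ((x + y) * y + 1)
sumGadget x y 6 = x * y
sumGadget x y 7 = x * y + 1
sumGadget x y 8 = (x + y) * (x + y)
sumGadget x y 9 = (x + y) * (x + y) * (x * y + 1)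
sumGadget x y _ = 0

output : Valuation → Instr → ℕ → ℕ
output g one        _ = 1
output g (succ i)   _ = g i + 1
output g (prod i j) _ = g i * g j
output g (sum i j)  t = sumGadget (g i) (g j) t

constraints : ℕ → Instr → List Constraint
constraints k one        = mul k k k ∷ []
constraints k (succ i)   = inc i k ∷ []
constraints k (prod i j) = mul i j k ∷ []
constraints k (sum i j)  =
  mul k i (1 + k) ∷ inc (1 + k) (2 + k) ∷ mul k j (3 + k) ∷ inc (3 + k) (4 + k) ∷
  mul (2 + k) (4 + k) (5 + k) ∷ mul i j (6 + k) ∷ inc (6 + k) (7 + k) ∷
  mul k k (8 + k) ∷ mul (8 + k) (7 + k) (9 + k) ∷ inc (9 + k) (5 + k) ∷ []

Computes : Valuation → ℕ → Instr → Set
Computes g k ι = ∀ t → t < width ι → g (t + k) ≡ output g ι t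

ReadsBelow : ℕ → Instr → Set
ReadsBelow k one        = ⊤
ReadsBelow k (succ i)   = i < k
ReadsBelow k (prod i j) = i < k × j < k
ReadsBelow k (sum i j)  = i < k × j < k

output-cong : ∀ {g f k} ι t → AgreeBelow k g f → ReadsBelow k ι → output g ι t ≡ output f ι t
output-cong one        t g≗f _          = refl
output-cong (succ i)   t g≗f i<k        = cong (_+ 1) (g≗f i i<k)
output-cong (prod i j) t g≗f (i<k , j<k) = cong₂ _*_ (g≗f i i<k) (g≗f j j<k)
output-cong (sum i j)  t g≗f (i<k , j<k) = cong₂ (λ x y → sumGadget x y t) (g≗f i i<k) (g≗f j j<k)

*-positive : ∀ {a b} → 1 ≤ a → 1 ≤ b → 1 ≤ a * b
*-positive {suc a} {suc b} _ _ = s≤s z≤n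

+1-positive : ∀ a → 1 ≤ a + 1
+1-positive a = m≤n+m 1 a

sumGadget-positive : ∀ {x y} t → 1 ≤ x → 1 ≤ y → t < 10 → 1 ≤ sumGadget x y t
sumGadget-positive {x} {y} t 1≤x 1≤y t<10 = go t t<10
  where
  1≤x+y : 1 ≤ x + y
  1≤x+y = ≤-trans 1≤x (m≤m+n x y)
  go : ∀ t → t < 10 → 1 ≤ sumGadget x y t
  go 0 _ = 1≤x+y
  go 1 _ = *-positive 1≤x+y 1≤x
  go 2 _ = +1-positive _
  go 3 _ = *-positive 1≤x+y 1≤y
  go 4 _ = +1-positive _
  go 5 _ = *-positive (+1-positive ((x + y) * x)) (+1-positive ((x + y) * y))
  go 6 _ = *-positive 1≤x 1≤y
  go 7 _ = +1-positive _
  go 8 _ = *-positive 1≤x+y 1≤x+y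
  go 9 _ = *-positive (*-positive 1≤x+y 1≤x+y) (+1-positive _)
  go (suc (suc (suc (suc (suc (suc (suc (suc (suc (suc _))))))))))
     (s≤s (s≤s (s≤s (s≤s (s≤s (s≤s (s≤s (s≤s (s≤s (s≤s ()))))))))))

output-positive : ∀ {g k} ι t → PositiveBelow k g → ReadsBelow k ι → t < width ι → 1 ≤ output g ι t
output-positive one        t pos _           _    = s≤s z≤n
output-positive (succ i)   t pos _           _    = +1-positive _
output-positive (prod i j) t pos (i<k , j<k) _    = *-positive (pos i i<k) (pos j j<k)
output-positive (sum i j)  t pos (i<k , j<k) t<10 = sumGadget-positive t (pos i i<k) (pos j j<k) t<10

sum-computes : ∀ {g k} i j → 1 ≤ g k → All (g ⊨_) (constraints k (sum i j)) → Computes g k (sum i j)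
sum-computes {g} {k} i j 1≤gk (e₁ ∷ e₂ ∷ e₃ ∷ e₄ ∷ e₅ ∷ e₆ ∷ e₇ ∷ e₈ ∷ e₉ ∷ e₁₀ ∷ []) = go
  where
  x = g i
  y = g j
  r₀ : g k ≡ x + y
  r₀ = sum-forced (g k) x y 1≤gk (begin
    (g k * x + 1) * (g k * y + 1)
      ≡⟨ cong₂ _*_ (trans (cong (_+ 1) e₁) e₂) (trans (cong (_+ 1) e₃) e₄) ⟩
    g (2 + k) * g (4 + k)           ≡⟨ e₅ ⟩
    g (5 + k)                       ≡⟨ e₁₀ ⟨
    g (9 + k) + 1                   ≡⟨ cong (_+ 1) (trans (sym e₉) (cong₂ _*_ (sym e₈) (sym e₇))) ⟩
    g k * g k * (g (6 + k) + 1) + 1 ≡⟨ cong (λ w → g k * g k * (w + 1) + 1) (sym e₆) ⟩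
    g k * g k * (x * y + 1) + 1     ∎)
    where open ≡-Reasoning
  r₁ = trans (sym e₁) (cong (_* x) r₀)
  r₂ = trans (sym e₂) (cong (_+ 1) r₁)
  r₃ = trans (sym e₃) (cong (_* y) r₀)
  r₄ = trans (sym e₄) (cong (_+ 1) r₃)
  r₆ = sym e₆
  r₇ = trans (sym e₇) (cong (_+ 1) r₆)
  r₈ = trans (sym e₈) (cong₂ _*_ r₀ r₀)
  go : Computes g k (sum i j)
  go 0 _ = r₀
  go 1 _ = r₁
  go 2 _ = r₂
  go 3 _ = r₃
  go 4 _ = r₄
  go 5 _ = trans (sym e₅) (cong₂ _*_ r₂ r₄)
  go 6 _ = r₆
  go 7 _ = r₇
  go 8 _ = r₈
  go 9 _ = trans (sym e₉) (cong₂ _*_ r₈ r₇)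
  go (suc (suc (suc (suc (suc (suc (suc (suc (suc (suc _))))))))))
     (s≤s (s≤s (s≤s (s≤s (s≤s (s≤s (s≤s (s≤s (s≤s (s≤s ()))))))))))

computes-from-constraints : ∀ {g k} ι → Positive g → All (g ⊨_) (constraints k ι) → Computes g k ι
computes-from-constraints {k = k} (sum i j) pos es = sum-computes i j (pos k) es
computes-from-constraints {g} {k} one pos (e ∷ []) 0 _ =
  sym (*-cancelˡ-≡ 1 (g k) (g k) {{>-nonZero (pos k)}} (trans (*-identityʳ (g k)) (sym e)))
computes-from-constraints (succ i)   pos (e ∷ []) 0 _ = sym e
computes-from-constraints (prod i j) pos (e ∷ []) 0 _ = sym e
computes-from-constraints one        pos _ (suc _) (s≤s ())
computes-from-constraints (succ _)   pos _ (suc _) (s≤s ())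
computes-from-constraints (prod _ _) pos _ (suc _) (s≤s ())

sumGadget-check : ∀ x y → (x + y) * (x + y) * (x * y + 1) + 1 ≡ ((x + y) * x + 1) * ((x + y) * y + 1)
sumGadget-check = solve-∀

constraints-from-computes : ∀ {g k} ι → Computes g k ι → All (g ⊨_) (constraints k ι)
constraints-from-computes one        c = trans (cong₂ _*_ gk≡1 gk≡1) (sym gk≡1) ∷ []
  where gk≡1 = c 0 (s≤s z≤n)
constraints-from-computes (succ i)   c = sym (c 0 (s≤s z≤n)) ∷ []
constraints-from-computes (prod i j) c = sym (c 0 (s≤s z≤n)) ∷ []
constraints-from-computes {g} {k} (sum i j) c =
  trans (cong (_* x) (r 0)) (sym (r 1)) ∷
  trans (cong (_+ 1) (r 1)) (sym (r 2)) ∷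
  trans (cong (_* y) (r 0)) (sym (r 3)) ∷
  trans (cong (_+ 1) (r 3)) (sym (r 4)) ∷
  trans (cong₂ _*_ (r 2) (r 4)) (sym (r 5)) ∷
  sym (r 6) ∷
  trans (cong (_+ 1) (r 6)) (sym (r 7)) ∷
  trans (cong₂ _*_ (r 0) (r 0)) (sym (r 8)) ∷
  trans (cong₂ _*_ (r 8) (r 7)) (sym (r 9)) ∷
  trans (cong (_+ 1) (r 9)) (trans (sumGadget-check x y) (sym (r 5))) ∷ []
  where
  x = g i
  y = g j
  r : ∀ t → {{True (t <? 10)}} → g (t + k) ≡ sumGadget x y t
  r t {{t<10}} = c t (toWitness t<10)

Program : Set
Program = List Instr

programWidth : Program → ℕ
programWidth []      = 0
programWidth (ι ∷ P) = width ι + programWidth P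

Executes : Valuation → ℕ → Program → Set
Executes g k []      = ⊤
Executes g k (ι ∷ P) = Computes g k ι × Executes g (width ι + k) P

WellFormed : ℕ → Program → Set
WellFormed k []      = ⊤
WellFormed k (ι ∷ P) = ReadsBelow k ι × WellFormed (width ι + k) P

programConstraints : ℕ → Program → List Constraint
programConstraints k []      = []
programConstraints k (ι ∷ P) = constraints k ι ++ programConstraints (width ι + k) P

executes-from-constraints : ∀ {g} k P → Positive g → All (g ⊨_) (programConstraints k P) → Executes g k P
executes-from-constraints k []      pos _  = tt
executes-from-constraints k (ι ∷ P) pos cs =
  computes-from-constraints ι pos (proj₁ split) , executes-from-constraints (width ι + k) P pos (proj₂ split)
  where split = ++⁻ (constraints k ι) cs

constraints-from-executes : ∀ {g} k P → Executes g k P → All (g ⊨_) (programConstraints k P)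
constraints-from-executes k []      _       = []
constraints-from-executes k (ι ∷ P) (c , e) =
  ++⁺ (constraints-from-computes ι c) (constraints-from-executes (width ι + k) P e)

programWidth-++ : ∀ P Q → programWidth (P ++ Q) ≡ programWidth P + programWidth Q
programWidth-++ []      Q = refl
programWidth-++ (ι ∷ P) Q = trans (cong (width ι +_) (programWidth-++ P Q)) (sym (+-assoc (width ι) _ _))

executes-++⁻ : ∀ {g} k P Q → Executes g k (P ++ Q) → Executes g k P × Executes g (programWidth P + k) Q
executes-++⁻ k []      Q e       = tt , e
executes-++⁻ {g} k (ι ∷ P) Q (c , e) =
  (c , proj₁ rest) , subst (λ l → Executes g l Q) (x∙yz≈yx∙z (programWidth P) (width ι) k) (proj₂ rest)
  where rest = executes-++⁻ (width ι + k) P Q e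

wellFormed-++ : ∀ k P Q → WellFormed k P → WellFormed (programWidth P + k) Q → WellFormed k (P ++ Q)
wellFormed-++ k []      Q _       wQ = wQ
wellFormed-++ k (ι ∷ P) Q (r , wP) wQ =
  r , wellFormed-++ (width ι + k) P Q wP
        (subst (λ l → WellFormed l Q) (sym (x∙yz≈yx∙z (programWidth P) (width ι) k)) wQ)

below-or-offset : ∀ {m} w k → m < w + k → m < k ⊎ ∃[ t ] (t < w × m ≡ t + k)
below-or-offset {m} w k m<w+k with m <? k
... | yes m<k = inj₁ m<k
... | no m≮k  = inj₂ (m ∸ k , +-cancelʳ-< k _ w (subst (_< w + k) (sym m∸k+k≡m) m<w+k) , sym m∸k+k≡m)
  where m∸k+k≡m = m∸n+n≡m (≮⇒≥ m≮k)

write : Valuation → ℕ → ℕ → (ℕ → ℕ) → Valuation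
write f k w v m with m <? k | m ∸ k <? w
... | yes _ | _     = f m
... | no _  | yes _ = v (m ∸ k)
... | no _  | no _  = f m

write-below : ∀ f k w v {m} → m < k → write f k w v m ≡ f m
write-below f k w v {m} m<k with m <? k
... | yes _  = refl
... | no m≮k = ⊥-elim (m≮k m<k)

write-at : ∀ f k w v {t} → t < w → write f k w v (t + k) ≡ v t
write-at f k w v {t} t<w with t + k <? k | t + k ∸ k <? w
... | yes t+k<k | _     = ⊥-elim (<-irrefl refl (<-≤-trans t+k<k (m≤n+m k t)))
... | no _  | yes _     = cong v (m+n∸n≡m t k)
... | no _  | no t+k∸k≮w = ⊥-elim (t+k∸k≮w (subst (_< w) (sym (m+n∸n≡m t k)) t<w))

run : Valuation → ℕ → Program → Valuation
run f k []      = f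
run f k (ι ∷ P) = run (write f k (width ι) (output f ι)) (width ι + k) P

run-below : ∀ f k P {m} → m < k → run f k P m ≡ f m
run-below f k []      m<k = refl
run-below f k (ι ∷ P) m<k =
  trans (run-below _ (width ι + k) P (<-≤-trans m<k (m≤n+m k (width ι)))) (write-below f k (width ι) _ m<k)

write-preserves : ∀ f k w v (Q : ℕ → ℕ → Set) →
                  (∀ m → m < k → Q m (f m)) → (∀ t → t < w → Q (t + k) (v t)) →
                  ∀ m → m < w + k → Q m (write f k w v m)
write-preserves f k w v Q below at m m<w+k with below-or-offset w k m<w+k
... | inj₁ m<k             = subst (Q m) (sym (write-below f k w v m<k)) (below m m<k)
... | inj₂ (t , t<w , refl) = subst (Q (t + k)) (sym (write-at f k w v t<w)) (at t t<w)

run-executes : ∀ f k P → WellFormed k P → Executes (run f k P) k P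
run-executes f k []      _        = tt
run-executes f k (ι ∷ P) (r , wP) = computes , run-executes f′ (width ι + k) P wP
  where
  f′ = write f k (width ι) (output f ι)
  g  = run f′ (width ι + k) P
  g≗f : AgreeBelow k g f
  g≗f m m<k = run-below f k (ι ∷ P) m<k
  computes : Computes g k ι
  computes t t<w = begin
    g (t + k)      ≡⟨ run-below f′ (width ι + k) P (+-monoˡ-< k t<w) ⟩
    f′ (t + k)     ≡⟨ write-at f k (width ι) (output f ι) t<w ⟩
    output f ι t   ≡⟨ output-cong ι t g≗f r ⟨
    output g ι t   ∎
    where open ≡-Reasoning

executes⇒run : ∀ {g} f k P → AgreeBelow k g f → Executes g k P → WellFormed k P →
               AgreeBelow (programWidth P + k) g (run f k P)
executes⇒run f k []      g≗f _       _        = g≗f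
executes⇒run {g} f k (ι ∷ P) g≗f (c , e) (r , wP) =
  subst (λ l → AgreeBelow l g (run f′ (width ι + k) P)) (x∙yz≈yx∙z (programWidth P) (width ι) k)
    (executes⇒run f′ (width ι + k) P g≗f′ e wP)
  where
  f′ = write f k (width ι) (output f ι)
  g≗f′ : AgreeBelow (width ι + k) g f′
  g≗f′ = write-preserves f k (width ι) (output f ι) (λ m a → g m ≡ a) g≗f
           (λ t t<w → trans (c t t<w) (output-cong ι t g≗f r))

run-positive : ∀ f k P → PositiveBelow k f → WellFormed k P → PositiveBelow (programWidth P + k) (run f k P)
run-positive f k []      pos _        = pos
run-positive f k (ι ∷ P) pos (r , wP) =
  subst (λ l → PositiveBelow l (run f′ (width ι + k) P)) (x∙yz≈yx∙z (programWidth P) (width ι) k)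
    (run-positive f′ (width ι + k) P pos′ wP)
  where
  f′ = write f k (width ι) (output f ι)
  pos′ : PositiveBelow (width ι + k) f′
  pos′ = write-preserves f k (width ι) (output f ι) (λ _ a → 1 ≤ a) pos
           (λ t t<w → output-positive ι t pos r t<w)

executes-cong : ∀ {g f} k P → AgreeBelow (programWidth P + k) g f → WellFormed k P →
                Executes f k P → Executes g k P
executes-cong k []      _   _        _       = tt
executes-cong {g} {f} k (ι ∷ P) g≗f (r , wP) (c , e) = computes , executes-cong (width ι + k) P g≗f′ wP e
  where
  g≗f′ : AgreeBelow (programWidth P + (width ι + k)) g f
  g≗f′ m m<l = g≗f m (subst (m <_) (x∙yz≈yx∙z (programWidth P) (width ι) k) m<l)
  g≗fᵏ : AgreeBelow k g f
  g≗fᵏ m m<k = g≗f m (<-≤-trans m<k (m≤n+m k (width ι + programWidth P)))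
  computes : Computes g k ι
  computes t t<w = begin
    g (t + k)      ≡⟨ g≗f (t + k) (+-monoˡ-< k (<-≤-trans t<w (m≤m+n (width ι) (programWidth P)))) ⟩
    f (t + k)      ≡⟨ c t t<w ⟩
    output f ι t   ≡⟨ output-cong ι t g≗fᵏ r ⟨
    output g ι t   ∎
    where open ≡-Reasoning

Pair : Set
Pair = ℕ × ℕ

Below : ℕ → Pair → Set
Below B (a , b) = a < B × b < B

Below-mono : ∀ {B B′} u → B ≤ B′ → Below B u → Below B′ u
Below-mono _ B≤B′ (a<B , b<B) = <-≤-trans a<B B≤B′ , <-≤-trans b<B B≤B′

difference : ℕ → ℕ → ℤ
difference a b = ℤ.+ a ℤ.- ℤ.+ b

⟦_⟧ : Pair → Valuation → ℤ
⟦ a , b ⟧ g = difference (g a) (g b)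

⟦⟧≡0⇒≡ : ∀ {g} a b → ⟦ a , b ⟧ g ≡ ℤ.+ 0 → g a ≡ g b
⟦⟧≡0⇒≡ _ _ e = ℤ.+-injective (ℤ.i-j≡0⇒i≡j _ _ e)

≡⇒⟦⟧≡0 : ∀ {g} a b → g a ≡ g b → ⟦ a , b ⟧ g ≡ ℤ.+ 0
≡⇒⟦⟧≡0 {g} a b e = trans (cong (difference (g a)) (sym e)) (ℤ.+-inverseʳ (ℤ.+ g a))

difference-+ : ∀ a b c d → difference (a + c) (b + d) ≡ difference a b ℤ.+ difference c d
difference-+ a b c d =
  trans (cong₂ ℤ._-_ (ℤ.pos-+ a c) (ℤ.pos-+ b d)) (ring (ℤ.+ a) (ℤ.+ b) (ℤ.+ c) (ℤ.+ d))
  where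
  ring : ∀ (A B C D : ℤ) → (A ℤ.+ C) ℤ.- (B ℤ.+ D) ≡ (A ℤ.- B) ℤ.+ (C ℤ.- D)
  ring = ℤ-Solver.solve-∀

difference-* : ∀ a b c d → difference (a * c + b * d) (a * d + b * c) ≡ difference a b ℤ.* difference c d
difference-* a b c d =
  trans (cong₂ ℤ._-_ (pos-+-* a c b d) (pos-+-* a d b c)) (ring (ℤ.+ a) (ℤ.+ b) (ℤ.+ c) (ℤ.+ d))
  where
  ring : ∀ (A B C D : ℤ) →
         (A ℤ.* C ℤ.+ B ℤ.* D) ℤ.- (A ℤ.* D ℤ.+ B ℤ.* C) ≡ (A ℤ.- B) ℤ.* (C ℤ.- D)
  ring = ℤ-Solver.solve-∀
  pos-+-* : ∀ a c b d → ℤ.+ (a * c + b * d) ≡ ℤ.+ a ℤ.* ℤ.+ c ℤ.+ ℤ.+ b ℤ.* ℤ.+ d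
  pos-+-* a c b d = trans (ℤ.pos-+ (a * c) (b * d)) (cong₂ ℤ._+_ (ℤ.pos-* a c) (ℤ.pos-* b d))

data Op : Set where
  plus times : Op

applyℤ : Op → ℤ → ℤ → ℤ
applyℤ plus  = ℤ._+_
applyℤ times = ℤ._*_

-- Products use (a - b)(c - d) = (a c + b d) - (a d + b c).
gadget : Op → Pair → Pair → ℕ → Program
gadget plus  (a , b) (c , d) s = sum a c ∷ sum b d ∷ []
gadget times (a , b) (c , d) s =
  prod a c ∷ prod b d ∷ prod a d ∷ prod b c ∷ sum s (1 + s) ∷ sum (2 + s) (3 + s) ∷ []

gadgetResult : Op → ℕ → Pair
gadgetResult plus  s = s , 10 + s
gadgetResult times s = 4 + s , 14 + s

opWidth : Op → ℕ
opWidth plus  = 20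
opWidth times = 24

gadget-width : ∀ op u v s → programWidth (gadget op u v s) ≡ opWidth op
gadget-width plus  _ _ _ = refl
gadget-width times _ _ _ = refl

shift< : ∀ a b s → {{True (a <? b)}} → a + s < b + s
shift< a b s {{a<b}} = +-monoˡ-< s (toWitness a<b)

<-+ˡ : ∀ {x s} w → x < s → x < w + s
<-+ˡ {s = s} w x<s = <-≤-trans x<s (m≤n+m s w)

gadget-wellFormed : ∀ op {u v s} → Below s u → Below s v → WellFormed s (gadget op u v s)
gadget-wellFormed plus (a<s , b<s) (c<s , d<s) = (a<s , c<s) , (<-+ˡ 10 b<s , <-+ˡ 10 d<s) , tt
gadget-wellFormed times {s = s} (a<s , b<s) (c<s , d<s) =
  (a<s , c<s) , (<-+ˡ 1 b<s , <-+ˡ 1 d<s) , (<-+ˡ 2 a<s , <-+ˡ 2 d<s) , (<-+ˡ 3 b<s , <-+ˡ 3 c<s) ,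
  (shift< 0 4 s , shift< 1 4 s) , (shift< 2 14 s , shift< 3 14 s) , tt

gadgetResult-below : ∀ op s → Below (opWidth op + s) (gadgetResult op s)
gadgetResult-below plus  s = shift< 0 20 s , shift< 10 20 s
gadgetResult-below times s = shift< 4 24 s , shift< 14 24 s

gadget-correct : ∀ {g} op u v s → Executes g s (gadget op u v s) →
                 ⟦ gadgetResult op s ⟧ g ≡ applyℤ op (⟦ u ⟧ g) (⟦ v ⟧ g)
gadget-correct {g} plus (a , b) (c , d) s (sum₁ , sum₂ , _) = begin
  difference (g s) (g (10 + s))        ≡⟨ cong₂ difference (sum₁ 0 (s≤s z≤n)) (sum₂ 0 (s≤s z≤n)) ⟩
  difference (g a + g c) (g b + g d)   ≡⟨ difference-+ (g a) (g b) (g c) (g d) ⟩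
  ⟦ a , b ⟧ g ℤ.+ ⟦ c , d ⟧ g          ∎
  where open ≡-Reasoning
gadget-correct {g} times (a , b) (c , d) s (ac , bd , ad , bc , sum₁ , sum₂ , _) = begin
  difference (g (4 + s)) (g (14 + s))
    ≡⟨ cong₂ difference (sum₁ 0 (s≤s z≤n)) (sum₂ 0 (s≤s z≤n)) ⟩
  difference (g s + g (1 + s)) (g (2 + s) + g (3 + s))
    ≡⟨ cong₂ difference (cong₂ _+_ (ac 0 (s≤s z≤n)) (bd 0 (s≤s z≤n)))
                        (cong₂ _+_ (ad 0 (s≤s z≤n)) (bc 0 (s≤s z≤n))) ⟩
  difference (g a * g c + g b * g d) (g a * g d + g b * g c)
    ≡⟨ difference-* (g a) (g b) (g c) (g d) ⟩
  ⟦ a , b ⟧ g ℤ.* ⟦ c , d ⟧ g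
    ∎
  where open ≡-Reasoning

maxConstant : ∀ {k} → Poly k → ℕ
maxConstant (con (ℤ.+ c))  = c
maxConstant (con -[1+ c ]) = suc c
maxConstant (var _)        = 0
maxConstant (p ⊕ q)        = maxConstant p ⊔ maxConstant q
maxConstant (p ⊗ q)        = maxConstant p ⊔ maxConstant q

codeWidth : ∀ {k} → Poly k → ℕ
codeWidth (con _) = 0
codeWidth (var _) = 0
codeWidth (p ⊕ q) = codeWidth p + codeWidth q + opWidth plus
codeWidth (p ⊗ q) = codeWidth p + codeWidth q + opWidth times

-- The constant c is read as (c + base) - base, so the registers c + base must hold c + 1.
module Compile (base : ℕ) {k : ℕ} (env : Fin k → Pair) where

  compile   : ℕ → Poly k → Program × Pair
  compileOp : Op → ℕ → Poly k → Poly k → Program × Pair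

  code : ℕ → Poly k → Program
  code s p = proj₁ (compile s p)

  result : ℕ → Poly k → Pair
  result s p = proj₂ (compile s p)

  compile s (con (ℤ.+ c))  = [] , (c + base , base)
  compile s (con -[1+ c ]) = [] , (base , suc c + base)
  compile s (var i)        = [] , env i
  compile s (p ⊕ q)        = compileOp plus s p q
  compile s (p ⊗ q)        = compileOp times s p q

  compileOp op s p q = code s p ++ code s₁ q ++ gadget op (result s p) (result s₁ q) s₂ , gadgetResult op s₂
    where
    s₁ = codeWidth p + s
    s₂ = codeWidth q + s₁

  compile-width   : ∀ s p → programWidth (code s p) ≡ codeWidth p
  compileOp-width : ∀ op s p q →
                    programWidth (proj₁ (compileOp op s p q)) ≡ codeWidth p + codeWidth q + opWidth op

  compile-width s (con (ℤ.+ _))  = refl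
  compile-width s (con -[1+ _ ]) = refl
  compile-width s (var _)        = refl
  compile-width s (p ⊕ q)        = compileOp-width plus s p q
  compile-width s (p ⊗ q)        = compileOp-width times s p q

  compileOp-width op s p q = begin
    programWidth (code s p ++ code s₁ q ++ G)
      ≡⟨ programWidth-++ (code s p) _ ⟩
    programWidth (code s p) + programWidth (code s₁ q ++ G)
      ≡⟨ cong (programWidth (code s p) +_) (programWidth-++ (code s₁ q) G) ⟩
    programWidth (code s p) + (programWidth (code s₁ q) + programWidth G)
      ≡⟨ cong₂ (λ x y → x + (y + programWidth G)) (compile-width s p) (compile-width s₁ q) ⟩
    codeWidth p + (codeWidth q + programWidth G)
      ≡⟨ cong (λ x → codeWidth p + (codeWidth q + x)) (gadget-width op _ _ _) ⟩
    codeWidth p + (codeWidth q + opWidth op)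
      ≡⟨ +-assoc (codeWidth p) _ _ ⟨
    codeWidth p + codeWidth q + opWidth op
      ∎
    where
    open ≡-Reasoning
    s₁ = codeWidth p + s
    G = gadget op (result s p) (result s₁ q) (codeWidth q + s₁)

  executes-compileOp : ∀ {g} op s p q → Executes g s (proj₁ (compileOp op s p q)) →
    let s₁ = codeWidth p + s ; s₂ = codeWidth q + s₁ in
    Executes g s (code s p) × Executes g s₁ (code s₁ q) ×
    Executes g s₂ (gadget op (result s p) (result s₁ q) s₂)
  executes-compileOp {g} op s p q e
    with executes-++⁻ s (code s p) _ e
  ... | eP , eRest rewrite compile-width s p
    with executes-++⁻ (codeWidth p + s) (code (codeWidth p + s) q) _ eRest
  ... | eQ , eG rewrite compile-width (codeWidth p + s) q = eP , eQ , eG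

  compile-wellFormed   : ∀ {B} s p → B ≤ s → (∀ i → Below B (env i)) → maxConstant p + base < B →
                         WellFormed s (code s p) × Below (codeWidth p + s) (result s p)
  compileOp-wellFormed : ∀ {B} op s p q → B ≤ s → (∀ i → Below B (env i)) →
                         maxConstant p ⊔ maxConstant q + base < B →
                         WellFormed s (proj₁ (compileOp op s p q)) ×
                         Below (codeWidth p + codeWidth q + opWidth op + s) (proj₂ (compileOp op s p q))

  compile-wellFormed s (con (ℤ.+ c)) B≤s _ c+base<B =
    tt , Below-mono (c + base , base) B≤s (c+base<B , ≤-<-trans (m≤n+m base c) c+base<B)
  compile-wellFormed s (con -[1+ c ]) B≤s _ c+base<B =
    tt , Below-mono (base , suc c + base) B≤s (≤-<-trans (m≤n+m base (suc c)) c+base<B , c+base<B)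
  compile-wellFormed s (var i) B≤s env<B _ = tt , Below-mono (env i) B≤s (env<B i)
  compile-wellFormed s (p ⊕ q) = compileOp-wellFormed plus s p q
  compile-wellFormed s (p ⊗ q) = compileOp-wellFormed times s p q

  compileOp-wellFormed {B} op s p q B≤s env<B max<B =
    wellFormed-++ s (code s p) _ wfP
      (subst (λ l → WellFormed (l + s) (code s₁ q ++ G)) (sym (compile-width s p))
        (wellFormed-++ s₁ (code s₁ q) G wfQ
          (subst (λ l → WellFormed (l + s₁) G) (sym (compile-width s₁ q)) wfG))) ,
    subst (λ l → Below l (gadgetResult op s₂)) (rearrange (codeWidth p) (codeWidth q) (opWidth op) s)
      (gadgetResult-below op s₂)
    where
    s₁ = codeWidth p + s
    s₂ = codeWidth q + s₁
    G = gadget op (result s p) (result s₁ q) s₂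
    IHp = compile-wellFormed s p B≤s env<B (≤-<-trans (+-monoˡ-≤ base (m≤m⊔n _ _)) max<B)
    IHq = compile-wellFormed s₁ q (≤-trans B≤s (m≤n+m s (codeWidth p))) env<B
            (≤-<-trans (+-monoˡ-≤ base (m≤n⊔m _ _)) max<B)
    wfP = proj₁ IHp
    wfQ = proj₁ IHq
    wfG : WellFormed s₂ G
    wfG = gadget-wellFormed op (Below-mono (result s p) (m≤n+m s₁ (codeWidth q)) (proj₂ IHp)) (proj₂ IHq)
    rearrange : ∀ a b c s → c + (b + (a + s)) ≡ a + b + c + s
    rearrange = solve-∀

  ConstantsBelow : ℕ → Valuation → Set
  ConstantsBelow C g = ∀ c → c ≤ C → g (c + base) ≡ suc c

  compile-correct   : ∀ {g} (v : Vec ℕ k) s p → ConstantsBelow (maxConstant p) g →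
                      (∀ i → ⟦ env i ⟧ g ≡ ℤ.+ lookup v i) → Executes g s (code s p) →
                      ⟦ result s p ⟧ g ≡ eval p v
  compileOp-correct : ∀ {g} (v : Vec ℕ k) op s p q → ConstantsBelow (maxConstant p ⊔ maxConstant q) g →
                      (∀ i → ⟦ env i ⟧ g ≡ ℤ.+ lookup v i) →
                      Executes g s (proj₁ (compileOp op s p q)) →
                      ⟦ proj₂ (compileOp op s p q) ⟧ g ≡ applyℤ op (eval p v) (eval q v)

  compile-correct v s (con (ℤ.+ c)) consts _ _ =
    cong₂ difference (consts c ≤-refl) (consts 0 z≤n)
  compile-correct v s (con -[1+ c ]) consts _ _ =
    cong₂ difference (consts 0 z≤n) (consts (suc c) ≤-refl)
  compile-correct v s (var i) _ env≡ _ = env≡ i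
  compile-correct v s (p ⊕ q) = compileOp-correct v plus s p q
  compile-correct v s (p ⊗ q) = compileOp-correct v times s p q

  compileOp-correct {g} v op s p q consts env≡ e with executes-compileOp op s p q e
  ... | eP , eQ , eG = begin
    ⟦ gadgetResult op s₂ ⟧ g
      ≡⟨ gadget-correct op (result s p) (result s₁ q) s₂ eG ⟩
    applyℤ op (⟦ result s p ⟧ g) (⟦ result s₁ q ⟧ g)
      ≡⟨ cong₂ (applyℤ op)
      (compile-correct v s p (λ c c≤ → consts c (≤-trans c≤ (m≤m⊔n _ _))) env≡ eP)
      (compile-correct v s₁ q (λ c c≤ → consts c (≤-trans c≤ (m≤n⊔m _ _))) env≡ eQ) ⟩
    applyℤ op (eval p v) (eval q v)
      ∎
    where
    open ≡-Reasoning
    s₁ = codeWidth p + s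
    s₂ = codeWidth q + s₁

counter : ℕ → ℕ → Program
counter p zero    = []
counter p (suc j) = succ p ∷ counter (suc p) j

counter-width : ∀ p j → programWidth (counter p j) ≡ j
counter-width p zero    = refl
counter-width p (suc j) = cong suc (counter-width (suc p) j)

counter-wellFormed : ∀ p j → WellFormed (suc p) (counter p j)
counter-wellFormed p zero    = tt
counter-wellFormed p (suc j) = ≤-refl , counter-wellFormed (suc p) j

counter-values : ∀ {g} p j → Executes g (suc p) (counter p j) → ∀ i → i ≤ j → g (i + p) ≡ i + g p
counter-values p j       _       zero    _        = refl
counter-values {g} p (suc j) (c , e) (suc i) (s≤s i≤j) = begin
  g (suc i + p)    ≡⟨ cong g (+-suc i p) ⟨
  g (i + suc p)    ≡⟨ counter-values (suc p) j e i i≤j ⟩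
  i + g (suc p)    ≡⟨ cong (i +_) (trans (c 0 (s≤s z≤n)) (+-comm (g p) 1)) ⟩
  i + suc (g p)    ≡⟨ +-suc i (g p) ⟩
  suc i + g p      ∎
  where open ≡-Reasoning

-- Indices beyond n are sent to the last element of Fin (suc n); they never occur below.
clamp : ∀ {n} → ℕ → Fin (suc n)
clamp {zero}  _       = Fin.zero
clamp {suc n} zero    = Fin.zero
clamp {suc n} (suc m) = Fin.suc (clamp m)

clamp-toℕ : ∀ {n} (i : Fin (suc n)) → clamp (toℕ i) ≡ i
clamp-toℕ {zero}  Fin.zero    = refl
clamp-toℕ {suc n} Fin.zero    = refl
clamp-toℕ {suc n} (Fin.suc i) = cong Fin.suc (clamp-toℕ i)

toℕ-clamp : ∀ {n} m → m < suc n → toℕ (clamp {n} m) ≡ m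
toℕ-clamp {zero}  zero    _         = refl
toℕ-clamp {zero}  (suc m) (s≤s ())
toℕ-clamp {suc n} zero    _         = refl
toℕ-clamp {suc n} (suc m) (s≤s m<1+n) = cong suc (toℕ-clamp m m<1+n)

entry : ∀ {r} → Vec ℕ r → ℕ → ℕ
entry Vec.[]       _       = 0
entry (y ∷ ys) zero    = y
entry (y ∷ ys) (suc j) = entry ys j

entry-toℕ : ∀ {r} (ys : Vec ℕ r) (i : Fin r) → entry ys (toℕ i) ≡ lookup ys i
entry-toℕ (y ∷ ys) Fin.zero    = refl
entry-toℕ (y ∷ ys) (Fin.suc i) = entry-toℕ ys i

valuationOf : ∀ {n} → Vec ℕ (suc n) → Valuation
valuationOf x m = lookup x (clamp m)

vectorOf : ∀ {n} → Valuation → Vec ℕ n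
vectorOf g = tabulate (λ i → g (toℕ i))

valuationOf-vectorOf : ∀ {n} g → AgreeBelow (suc n) (valuationOf (vectorOf {suc n} g)) g
valuationOf-vectorOf g m m<n =
  trans (Vec.lookup∘tabulate (λ i → g (toℕ i)) (clamp m)) (cong g (toℕ-clamp m m<n))

toEquation : ∀ {n} → Constraint → Equation (suc n)
toEquation (inc i k)   = plusOne (clamp i) (clamp k)
toEquation (mul i j k) = times (clamp i) (clamp j) (clamp k)

holds⇒⊨ : ∀ {n} (x : Vec ℕ (suc n)) e → Holds x (toEquation e) → valuationOf x ⊨ e
holds⇒⊨ x (inc _ _)   h = h
holds⇒⊨ x (mul _ _ _) h = h

⊨⇒holds : ∀ {n} (x : Vec ℕ (suc n)) e → valuationOf x ⊨ e → Holds x (toEquation e)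
⊨⇒holds x (inc _ _)   h = h
⊨⇒holds x (mul _ _ _) h = h

overhead : ∀ {r} → Poly (2 + r) → ℕ
overhead {r} W = 12 + r + codeWidth W

threshold : ∀ {r} → Poly (2 + r) → ℕ
threshold W = overhead W + overhead W + maxConstant W + 1

1≤threshold : ∀ {r} (W : Poly (2 + r)) → 1 ≤ threshold W
1≤threshold W = m≤n+m 1 (overhead W + overhead W + maxConstant W)

-- Registers: 0 holds x₂, 1 … r hold the yⱼ + 1, base … base + N hold 1 … N + 1 (the constants of W
-- among them), the sum gadget at sumAt computes (N + 1) + (K + 1) = n + 1, which represents x₁ = n,
-- succAt holds x₂ + 1, and the compiled W fills the rest, so that exactly n registers are used.
module Encoding {r : ℕ} (W : Poly (2 + r)) (n₀ : ℕ) (large : threshold W < suc n₀) where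

  n K N base sumAt succAt codeAt : ℕ
  n      = suc n₀
  K      = overhead W
  N      = n ∸ (K + 1)
  base   = suc r
  sumAt  = suc N + base
  succAt = 10 + sumAt
  codeAt = suc succAt

  env : Fin (2 + r) → Pair
  env Fin.zero                = sumAt , base
  env (Fin.suc Fin.zero)      = succAt , base
  env (Fin.suc (Fin.suc j))   = suc (toℕ j) , base

  open Compile base env

  Root : ℕ → Vec ℕ r → Set
  Root x₂ ys = eval W (n ∷ x₂ ∷ ys) ≡ ℤ.+ 0

  constantsPart restPart program : Program
  constantsPart = one ∷ counter base N
  restPart      = sum (N + base) (K + base) ∷ succ 0 ∷ code codeAt W
  program       = constantsPart ++ restPart

  rootCheck : Constraint
  rootCheck = mul (proj₁ (result codeAt W)) base (proj₂ (result codeAt W))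

  system : System n
  system = List.map toEquation (programConstraints base program ++ rootCheck ∷ [])

  N+[K+1]≡n : N + (K + 1) ≡ n
  N+[K+1]≡n = m∸n+n≡m (≤-trans (m≤m+n (K + 1) _) (<⇒≤ (subst (_< n) (rearrange K _) large)))
    where
    rearrange : ∀ a b → a + a + b + 1 ≡ (a + 1) + (a + b)
    rearrange = solve-∀

  K+c<N : K + maxConstant W < N
  K+c<N = +-cancelʳ-< (K + 1) _ N (subst₂ _<_ (rearrange K _) (sym N+[K+1]≡n) large)
    where
    rearrange : ∀ a b → a + a + b + 1 ≡ (a + b) + (a + 1)
    rearrange = solve-∀

  K≤N : K ≤ N
  K≤N = ≤-trans (m≤m+n K _) (<⇒≤ K+c<N)

  c≤N : maxConstant W ≤ N
  c≤N = ≤-trans (m≤n+m _ K) (<⇒≤ K+c<N)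

  program-width : programWidth program + base ≡ n
  program-width = begin
    programWidth program + base
      ≡⟨ cong (_+ base) (programWidth-++ constantsPart restPart) ⟩
    (suc (programWidth (counter base N)) + (11 + programWidth (code codeAt W))) + base
      ≡⟨ cong₂ (λ a b → (suc a + (11 + b)) + base) (counter-width base N) (compile-width codeAt W) ⟩
    (suc N + (11 + codeWidth W)) + suc r
      ≡⟨ rearrange N r (codeWidth W) ⟩
    N + (K + 1)
      ≡⟨ N+[K+1]≡n ⟩
    n ∎
    where
    open ≡-Reasoning
    rearrange : ∀ N r G → (suc N + (11 + G)) + suc r ≡ N + (12 + r + G + 1)
    rearrange = solve-∀

  code-end : codeWidth W + codeAt ≡ n
  code-end = trans (rearrange (codeWidth W) N r) N+[K+1]≡n
    where
    rearrange : ∀ G N r → G + suc (10 + (suc N + suc r)) ≡ N + (12 + r + G + 1)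
    rearrange = solve-∀

  base<codeAt : base < codeAt
  base<codeAt = s≤s (m≤n+m base (10 + suc N))

  env<codeAt : ∀ i → Below codeAt (env i)
  env<codeAt Fin.zero              = s≤s (m≤n+m sumAt 10) , base<codeAt
  env<codeAt (Fin.suc Fin.zero)    = ≤-refl , base<codeAt
  env<codeAt (Fin.suc (Fin.suc j)) = <-trans (s≤s (Fin.toℕ<n j)) base<codeAt , base<codeAt

  code-wellFormed : WellFormed codeAt (code codeAt W) × Below (codeWidth W + codeAt) (result codeAt W)
  code-wellFormed = compile-wellFormed codeAt W ≤-refl env<codeAt
    (≤-<-trans (+-monoˡ-≤ base c≤N) (s≤s (m≤n+m (N + base) 11)))

  program-wellFormed : WellFormed base program
  program-wellFormed = wellFormed-++ base constantsPart restPart (tt , counter-wellFormed base N)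
    (subst (λ l → WellFormed (suc l + base) restPart) (sym (counter-width base N))
      ((≤-refl , s≤s (+-monoˡ-≤ base K≤N)) , s≤s z≤n , proj₁ code-wellFormed))

  result<n : Below n (result codeAt W)
  result<n = subst (λ l → Below l (result codeAt W)) code-end (proj₂ code-wellFormed)

  record Layout (g : Valuation) : Set where
    field
      constants : ConstantsBelow N g
      sum≡n+1   : g sumAt ≡ suc n
      succ≡x₂+1 : g succAt ≡ suc (g 0)
      code-runs : Executes g codeAt (code codeAt W)

  layout : ∀ {g} → Executes g base program → Layout g
  layout {g} e with executes-++⁻ base constantsPart restPart e
  ... | (one-runs , counter-runs) , rest-runs rewrite counter-width base N with rest-runs
  ... | sum-runs , succ-runs , code-runs = record
    { constants = constants
    ; sum≡n+1   = sum≡n+1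
    ; succ≡x₂+1 = trans (succ-runs 0 (s≤s z≤n)) (+-comm (g 0) 1)
    ; code-runs = code-runs
    }
    where
    constants : ConstantsBelow N g
    constants c c≤N = begin
      g (c + base)    ≡⟨ counter-values base N counter-runs c c≤N ⟩
      c + g base      ≡⟨ cong (c +_) (one-runs 0 (s≤s z≤n)) ⟩
      c + 1           ≡⟨ +-comm c 1 ⟩
      suc c           ∎
      where open ≡-Reasoning
    sum≡n+1 : g sumAt ≡ suc n
    sum≡n+1 = begin
      g sumAt                              ≡⟨ sum-runs 0 (s≤s z≤n) ⟩
      g (N + base) + g (K + base)          ≡⟨ cong₂ _+_ (constants N ≤-refl) (constants K K≤N) ⟩
      suc N + suc K                        ≡⟨ rearrange N K ⟩
      suc (N + (K + 1))                    ≡⟨ cong suc N+[K+1]≡n ⟩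
      suc n                                ∎
      where
      open ≡-Reasoning
      rearrange : ∀ N K → suc N + suc K ≡ suc (N + (K + 1))
      rearrange = solve-∀

  decode : ∀ {g} (ys : Vec ℕ r) → Executes g base program →
           (∀ j → g (suc (toℕ j)) ≡ suc (lookup ys j)) →
           ⟦ result codeAt W ⟧ g ≡ eval W (n ∷ g 0 ∷ ys)
  decode {g} ys e ys≡ =
    compile-correct (n ∷ g 0 ∷ ys) codeAt W (λ c c≤ → constants c (≤-trans c≤ c≤N)) env≡ code-runs
    where
    open Layout (layout e)
    env≡ : ∀ i → ⟦ env i ⟧ g ≡ ℤ.+ lookup (n ∷ g 0 ∷ ys) i
    env≡ Fin.zero              = cong₂ difference sum≡n+1   (constants 0 z≤n)
    env≡ (Fin.suc Fin.zero)    = cong₂ difference succ≡x₂+1 (constants 0 z≤n)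
    env≡ (Fin.suc (Fin.suc j)) = cong₂ difference (ys≡ j)   (constants 0 z≤n)

  inputs : ℕ → Vec ℕ r → Valuation
  inputs x₂ ys zero    = x₂
  inputs x₂ ys (suc j) = suc (entry ys j)

  solution : ℕ → Vec ℕ r → Vec ℕ n
  solution x₂ ys = vectorOf (run (inputs x₂ ys) base program)

  toℕ<end : ∀ (i : Fin n) → toℕ i < programWidth program + base
  toℕ<end i = subst (toℕ i <_) (sym program-width) (Fin.toℕ<n i)

  codeAt≤n : codeAt ≤ n
  codeAt≤n = subst (codeAt ≤_) code-end (m≤n+m codeAt (codeWidth W))

  module _ (x₂ : ℕ) (ys : Vec ℕ r) where

    private
      V : Valuation
      V = run (inputs x₂ ys) base program

      V-runs : Executes V base program
      V-runs = run-executes (inputs x₂ ys) base program program-wellFormed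

      V-inputs : ∀ j → V (suc (toℕ j)) ≡ suc (lookup ys j)
      V-inputs j = trans (run-below _ base program (s≤s (Fin.toℕ<n j))) (cong suc (entry-toℕ ys j))

      V-x₂ : V 0 ≡ x₂
      V-x₂ = run-below _ base program (s≤s z≤n)

      sol≗V : AgreeBelow n (valuationOf (solution x₂ ys)) V
      sol≗V = valuationOf-vectorOf V

      sol-runs : Executes (valuationOf (solution x₂ ys)) base program
      sol-runs = executes-cong base program
                   (subst (λ l → AgreeBelow l (valuationOf (solution x₂ ys)) V) (sym program-width) sol≗V)
                   program-wellFormed V-runs

    solution-succAt : lookup (solution x₂ ys) (clamp succAt) ≡ suc x₂
    solution-succAt =
      trans (sol≗V succAt codeAt≤n) (trans (Layout.succ≡x₂+1 (layout V-runs)) (cong suc V-x₂))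

    solution-isSolution : 1 ≤ x₂ → Root x₂ ys → IsPosSolution system (solution x₂ ys)
    solution-isSolution 1≤x₂ root =
      positive , map⁺ (All.map (λ {e} → ⊨⇒holds (solution x₂ ys) e) holds)
      where
      open Layout (layout V-runs)
      a = proj₁ (result codeAt W)
      b = proj₂ (result codeAt W)
      positive : ∀ i → 1 ≤ lookup (solution x₂ ys) i
      positive i = subst (1 ≤_) (sym (Vec.lookup∘tabulate (λ i → V (toℕ i)) i))
        (run-positive (inputs x₂ ys) base program inputs-positive program-wellFormed (toℕ i) (toℕ<end i))
        where
        inputs-positive : PositiveBelow base (inputs x₂ ys)
        inputs-positive zero    _ = 1≤x₂
        inputs-positive (suc _) _ = s≤s z≤n
      Va≡Vb : V a ≡ V b
      Va≡Vb = ⟦⟧≡0⇒≡ {V} a b (begin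
        ⟦ result codeAt W ⟧ V   ≡⟨ decode ys V-runs V-inputs ⟩
        eval W (n ∷ V 0 ∷ ys)   ≡⟨ cong (λ z → eval W (n ∷ z ∷ ys)) V-x₂ ⟩
        eval W (n ∷ x₂ ∷ ys)    ≡⟨ root ⟩
        ℤ.+ 0                   ∎)
        where open ≡-Reasoning
      rootCheck-holds : valuationOf (solution x₂ ys) ⊨ rootCheck
      rootCheck-holds = begin
        valuationOf (solution x₂ ys) a * valuationOf (solution x₂ ys) base
          ≡⟨ cong₂ _*_ (sol≗V a (proj₁ result<n)) (sol≗V base (<-≤-trans base<codeAt codeAt≤n)) ⟩
        V a * V base  ≡⟨ cong (V a *_) (constants 0 z≤n) ⟩
        V a * 1       ≡⟨ *-identityʳ (V a) ⟩
        V a           ≡⟨ Va≡Vb ⟩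
        V b           ≡⟨ sol≗V b (proj₂ result<n) ⟨
        valuationOf (solution x₂ ys) b ∎
        where open ≡-Reasoning
      holds : All (valuationOf (solution x₂ ys) ⊨_) (programConstraints base program ++ rootCheck ∷ [])
      holds = ++⁺ (constraints-from-executes base program sol-runs) (rootCheck-holds ∷ [])

  inputsOf : Vec ℕ n → Vec ℕ r
  inputsOf x = tabulate (λ j → pred (valuationOf x (suc (toℕ j))))

  module _ {x : Vec ℕ n} (isSol : IsPosSolution system x) where

    private
      g : Valuation
      g = valuationOf x

      g-positive : Positive g
      g-positive m = proj₁ isSol (clamp m)

      holds : All (g ⊨_) (programConstraints base program ++ rootCheck ∷ [])
      holds = All.map (λ {e} → holds⇒⊨ x e) (map⁻ (proj₂ isSol))

      g-runs : Executes g base program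
      g-runs = executes-from-constraints base program g-positive (proj₁ (++⁻ _ holds))

      g-inputs : ∀ j → g (suc (toℕ j)) ≡ suc (lookup (inputsOf x) j)
      g-inputs j = sym (trans (cong suc (Vec.lookup∘tabulate _ j)) (suc-pred _ {{>-nonZero (g-positive _)}}))

    solution-root : Root (g 0) (inputsOf x)
    solution-root = trans (sym (decode (inputsOf x) g-runs g-inputs)) (≡⇒⟦⟧≡0 {g} a b ga≡gb)
      where
      a = proj₁ (result codeAt W)
      b = proj₂ (result codeAt W)
      ga≡gb : g a ≡ g b
      ga≡gb with proj₂ (++⁻ (programConstraints base program) holds)
      ... | rootCheck-holds ∷ [] = begin
        g a           ≡⟨ *-identityʳ (g a) ⟨
        g a * 1       ≡⟨ cong (g a *_) (Layout.constants (layout g-runs) 0 z≤n) ⟨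
        g a * g base  ≡⟨ rootCheck-holds ⟩
        g b           ∎
        where open ≡-Reasoning

    solution-unique : x ≡ solution (g 0) (inputsOf x)
    solution-unique = begin
      x                                 ≡⟨ Vec.tabulate∘lookup x ⟨
      tabulate (lookup x)               ≡⟨ Vec.tabulate-cong (λ i → cong (lookup x) (clamp-toℕ i)) ⟨
      vectorOf g                        ≡⟨ Vec.tabulate-cong (λ i → g≗run (toℕ i) (toℕ<end i)) ⟩
      solution (g 0) (inputsOf x)       ∎
      where
      open ≡-Reasoning
      g≗inputs : AgreeBelow base g (inputs (g 0) (inputsOf x))
      g≗inputs zero    _ = refl
      g≗inputs (suc j) (s≤s j<r) = begin
        g (suc j)                                 ≡⟨ cong (λ m → g (suc m)) (Fin.toℕ-fromℕ< j<r) ⟨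
        g (suc (toℕ (fromℕ< j<r)))                ≡⟨ g-inputs (fromℕ< j<r) ⟩
        suc (lookup (inputsOf x) (fromℕ< j<r))    ≡⟨ cong suc (entry-toℕ (inputsOf x) (fromℕ< j<r)) ⟨
        suc (entry (inputsOf x) (toℕ (fromℕ< j<r)))
          ≡⟨ cong (λ m → suc (entry (inputsOf x) m)) (Fin.toℕ-fromℕ< j<r) ⟩
        suc (entry (inputsOf x) j)                ∎
      g≗run : AgreeBelow (programWidth program + base) g (run (inputs (g 0) (inputsOf x)) base program)
      g≗run = executes⇒run (inputs (g 0) (inputsOf x)) base program g≗inputs g-runs program-wellFormed

  system-finite : ∀ x₂ → (∀ x₂′ → 1 ≤ x₂′ → ∀ ys → Root x₂′ ys → x₂ ≡ x₂′) →
                  FiniteSet (Root x₂) → FiniteSet (IsPosSolution system)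
  system-finite x₂ unique (L , complete) = List.map (solution x₂) L , covered
    where
    covered : ∀ x → IsPosSolution system x → x ∈ List.map (solution x₂) L
    covered x isSol = subst (_∈ List.map (solution x₂) L) (sym x≡) (∈-map⁺ (solution x₂) ys∈L)
      where
      x₂≡ : x₂ ≡ valuationOf x 0
      x₂≡ = unique (valuationOf x 0) (proj₁ isSol (clamp 0)) (inputsOf x) (solution-root isSol)
      x≡ : x ≡ solution x₂ (inputsOf x)
      x≡ = trans (solution-unique isSol) (cong (λ z → solution z (inputsOf x)) (sym x₂≡))
      ys∈L : inputsOf x ∈ L
      ys∈L = complete (inputsOf x) (subst (λ z → Root z (inputsOf x)) (sym x₂≡) (solution-root isSol))

theorem6 : (h : ℕ⁺ → ℕ⁺) → FiniteFoldDiophantine h →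
    ∃[ m ] (1 ≤ m × (∀ (n : ℕ) (n>m : m < n) (t : ℕ) → IsTau n t →
    proj₁ (h (n , >-pos n>m)) < t))
theorem6 h (r , W , represents , finiteFold) = threshold W , 1≤threshold W , bound
  where
  bound : ∀ n (n>m : threshold W < n) t → IsTau n t → proj₁ (h (n , >-pos n>m)) < t
  bound (suc n₀) large t (_ , τ-bounds , _) = begin-strict
    x₂                                       <⟨ n<1+n x₂ ⟩
    suc x₂                                   ≡⟨ solution-succAt x₂ ys ⟨
    lookup (solution x₂ ys) (clamp succAt)   ≤⟨ τ-bounds system finite _ isSolution (clamp succAt) ⟩
    t                                        ∎
    where
    open Encoding W n₀ large
    open ≤-Reasoning
    x₁ : ℕ⁺
    x₁ = suc n₀ , >-pos large
    x₂ = proj₁ (h x₁)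
    witness = Equivalence.to (represents x₁ (h x₁)) refl
    ys = proj₁ witness
    isSolution = solution-isSolution x₂ ys (proj₂ (h x₁)) (proj₂ witness)
    finite = system-finite x₂
      (λ x₂′ 1≤x₂′ ys′ root → Equivalence.from (represents x₁ (x₂′ , 1≤x₂′)) (ys′ , root))
      (finiteFold x₁ (h x₁))
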